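{- For any modal formula $A$, the following are equivalent: (1) $\mathbf{NR}\vdash A$; (2) $A$ is valid in all serial $\mathbf{N}$-frames; (3) $A$ is valid in all finite serial $\mathbf{N}$-frames; (4) $A$ is valid in all finite $\mathrm{Sub}(A)$-serial $\mathbf{N}$-frames.
   Context: Modal formulas are built from propositional variables and $\bot$ using $\neg,\land,\lor,\to$ and $\Box$; $\mathrm{Sub}(A)$ is the set of subformulas of $A$. $\mathbf{N}$ has all propositional tautologies as axioms and Modus Ponens and Necessitation $A/\Box A$ as rules; $\mathbf{NR}$ is $\mathbf{N}$ plus the rule $\neg B/\neg\Box B$. An $\mathbf{N}$-frame is $(W, \{\prec_B\}_B)$ with $W$ nonempty and a binary relation $\prec_B$ on $W$ for each modal formula $B$ (finite if $W$ is finite); an $\mathbf{N}$-model adds $\Vdash$ with usual propositional clauses and $x\Vdash\Box B$ iff $y\Vdash B$ for all $y$ with $x\prec_B y$. Validity in a frame means truth at all worlds of all models on the frame. The frame is $B$-serial if every $x$ has some $y$ with $x\prec_B y$; it is $\Gamma$-serial for a set $\Gamma$ of formulas if it is $B$-serial for every $B$ with $\Box B\in\Gamma$; it is serial if it is $B$-serial for all $B$. -}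

module Defs where

open import Data.Nat using (ℕ)
open import Data.Bool using (Bool; true; false; _∧_; _∨_; not)
open import Data.Product using (Σ; ∃; _×_; _,_)
open import Data.Fin using (Fin)
open import Relation.Binary.PropositionalEquality using (_≡_)
open import Function.Bundles using (_↔_; _⇔_)
open import Level using (Level; suc; zero)

infixr 6 _∧'_
infixr 5 _∨'_
infixr 4 _⇒_

data Fm : Set where
  var  : ℕ → Fm
  ⊥'   : Fm
  ¬'_  : Fm → Fm
  _∧'_ : Fm → Fm → Fm
  _∨'_ : Fm → Fm → Fm
  _⇒_  : Fm → Fm → Fm
  □_   : Fm → Fm

data _∈Sub_ : Fm → Fm → Set where
  here  : ∀ {A} → A ∈Sub A
  in¬   : ∀ {B A} → B ∈Sub A → B ∈Sub (¬' A)
  in∧ˡ  : ∀ {B A C} → B ∈Sub A → B ∈Sub (A ∧' C)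
  in∧ʳ  : ∀ {B A C} → B ∈Sub C → B ∈Sub (A ∧' C)
  in∨ˡ  : ∀ {B A C} → B ∈Sub A → B ∈Sub (A ∨' C)
  in∨ʳ  : ∀ {B A C} → B ∈Sub C → B ∈Sub (A ∨' C)
  in⇒ˡ  : ∀ {B A C} → B ∈Sub A → B ∈Sub (A ⇒ C)
  in⇒ʳ  : ∀ {B A C} → B ∈Sub C → B ∈Sub (A ⇒ C)
  in□   : ∀ {B A} → B ∈Sub A → B ∈Sub (□ A)

evalP : (ℕ → Bool) → (Fm → Bool) → Fm → Bool
evalP v b (var n)  = v n
evalP v b ⊥'       = false
evalP v b (¬' A)   = not (evalP v b A)
evalP v b (A ∧' B) = evalP v b A ∧ evalP v b B
evalP v b (A ∨' B) = evalP v b A ∨ evalP v b B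
evalP v b (A ⇒ B)  = not (evalP v b A) ∨ evalP v b B
evalP v b (□ A)    = b A

-- A is a propositional tautology (substitution instance of a classical tautology)
Tautology : Fm → Set
Tautology A = ∀ (v : ℕ → Bool) (b : Fm → Bool) → evalP v b A ≡ true

data NR⊢_ : Fm → Set where
  taut : ∀ {A} → Tautology A → NR⊢ A
  mp   : ∀ {A B} → NR⊢ (A ⇒ B) → NR⊢ A → NR⊢ B
  nec  : ∀ {A} → NR⊢ A → NR⊢ (□ A)
  ruleR : ∀ {B} → NR⊢ (¬' B) → NR⊢ (¬' (□ B))

record NFrame : Set₁ where
  field
    W    : Set
    w₀   : W
    rel  : Fm → W → W → Set

record IsForcing (F : NFrame) (V : ℕ → NFrame.W F → Bool)
                 (force : NFrame.W F → Fm → Bool) : Set where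
  open NFrame F
  field
    f-var : ∀ x n → force x (var n) ≡ V n x
    f-⊥   : ∀ x → force x ⊥' ≡ false
    f-¬   : ∀ x A → force x (¬' A) ≡ not (force x A)
    f-∧   : ∀ x A B → force x (A ∧' B) ≡ force x A ∧ force x B
    f-∨   : ∀ x A B → force x (A ∨' B) ≡ force x A ∨ force x B
    f-⇒   : ∀ x A B → force x (A ⇒ B) ≡ not (force x A) ∨ force x B
    f-□   : ∀ x B → force x (□ B) ≡ true ⇔ (∀ y → rel B x y → force y B ≡ true)

ValidIn : NFrame → Fm → Set
ValidIn F A = ∀ (V : ℕ → NFrame.W F → Bool) (force : NFrame.W F → Fm → Bool)
            → IsForcing F V force → ∀ x → force x A ≡ true

Finite : NFrame → Set
Finite F = Σ ℕ λ n → NFrame.W F ↔ Fin n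

BSerial : NFrame → Fm → Set
BSerial F B = ∀ x → ∃ λ y → NFrame.rel F B x y

Serial : NFrame → Set
Serial F = ∀ B → BSerial F B

SubSerial : Fm → NFrame → Set
SubSerial A F = ∀ B → (□ B) ∈Sub A → BSerial F B

-- Soundness: rule R is valid exactly because a B-serial world has a B-successor.
-- Completeness, together with validity in Sub(A)-serial frames, comes from a verdict for
-- every formula A, computed by recursion on the nesting of boxes: either NR ⊢ A and A holds
-- in all Sub(A)-serial frames, or A is false at the root of a finite deterministic model.
-- Given verdicts for B and ¬B for each atom □B of A, call a valuation of the propositional
-- atoms of A admissible if it gives each □B a value that B takes at the root of such a
-- model. If some admissible valuation falsifies A, grafting those models below a new root
-- refutes A. Otherwise A follows tautologically from the theorems □B (B provable, by
-- necessitation) and ¬□B (¬B provable, by rule R), and each world of a Sub(A)-serial frame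
-- induces an admissible valuation, so A holds there.
module Submission where

open import Defs
open import Data.Bool using (Bool; true; false; _∧_; _∨_; not)
open import Data.Bool.Properties using (¬-not; not-¬; not-injective) renaming (_≟_ to _≟ᵇ_)
open import Data.Empty using (⊥-elim)
open import Data.Fin using (Fin)
open import Data.Fin.Properties using (+↔⊎; 1↔⊤)
open import Data.List using (List; []; _∷_; _++_)
open import Data.List.Membership.Propositional using (_∈_)
open import Data.List.Membership.Propositional.Properties using (∈-++⁺ˡ; ∈-++⁺ʳ; ∈-++⁻)
open import Data.List.Relation.Unary.All as All using (All; []; _∷_)
open import Data.List.Relation.Unary.All.Properties using (++⁺)
open import Data.List.Relation.Unary.Any using (here; there)
open import Data.Nat using (ℕ; _+_)
import Data.Nat.Properties as ℕ
open import Data.Product using (_×_; Σ; ∃; _,_; proj₁; uncurry)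
open import Data.Sum using (_⊎_; inj₁; inj₂; [_,_])
open import Data.Sum.Function.Propositional using (_⊎-↔_)
import Data.Sum.Properties as Sum
open import Data.Tree.Binary using (Tree; leaf; node)
open import Data.Unit using (⊤; tt)
import Data.Unit.Polymorphic as Poly
open import Function using (_∘_)
open import Function.Bundles using (_⇔_; _↔_; mk⇔; Equivalence)
open import Function.Properties.Inverse using (↔-trans; ↔-sym)
open import Relation.Binary.Definitions using (DecidableEquality)
open import Relation.Binary.PropositionalEquality
  using (_≡_; _≢_; refl; sym; trans; cong; cong₂; subst; module ≡-Reasoning)
open import Relation.Nullary using (¬_; Dec; yes; no)
open import Relation.Nullary.Decidable using (map′; _×-dec_)
import Data.List.Membership.DecPropositional as DecMembership

tree-≡-dec : ∀ {N L : Set} → DecidableEquality N → DecidableEquality L → DecidableEquality (Tree N L)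
tree-≡-dec {N} {L} _≟ₙ_ _≟ₗ_ = go
  where
  go : DecidableEquality (Tree N L)
  go (leaf x) (leaf y) = map′ (cong leaf) (λ { refl → refl }) (x ≟ₗ y)
  go (node l m r) (node l′ m′ r′) =
    map′ (λ { (refl , refl , refl) → refl }) (λ { refl → refl , refl , refl })
         (go l l′ ×-dec m ≟ₙ m′ ×-dec go r r′)
  go (leaf _) (node _ _ _) = no λ ()
  go (node _ _ _) (leaf _) = no λ ()

encode : Fm → Tree ℕ ℕ
encode (var n)  = leaf n
encode ⊥'       = node (leaf 0) 0 (leaf 0)
encode (¬' A)   = node (encode A) 1 (leaf 0)
encode (A ∧' B) = node (encode A) 2 (encode B)
encode (A ∨' B) = node (encode A) 3 (encode B)
encode (A ⇒ B)  = node (encode A) 4 (encode B)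
encode (□ A)    = node (encode A) 5 (leaf 0)

decode : Tree ℕ ℕ → Fm
decode (leaf n)     = var n
decode (node l 1 _) = ¬' decode l
decode (node l 2 r) = decode l ∧' decode r
decode (node l 3 r) = decode l ∨' decode r
decode (node l 4 r) = decode l ⇒ decode r
decode (node l 5 _) = □ decode l
decode (node _ _ _) = ⊥'

decode-encode : ∀ A → decode (encode A) ≡ A
decode-encode (var n)  = refl
decode-encode ⊥'       = refl
decode-encode (¬' A)   = cong ¬'_ (decode-encode A)
decode-encode (A ∧' B) = cong₂ _∧'_ (decode-encode A) (decode-encode B)
decode-encode (A ∨' B) = cong₂ _∨'_ (decode-encode A) (decode-encode B)
decode-encode (A ⇒ B)  = cong₂ _⇒_ (decode-encode A) (decode-encode B)
decode-encode (□ A)    = cong □_ (decode-encode A)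

_≟_ : DecidableEquality Fm
A ≟ B = map′ encode-injective (cong encode) (tree-≡-dec ℕ._≟_ ℕ._≟_ (encode A) (encode B))
  where
  encode-injective : encode A ≡ encode B → A ≡ B
  encode-injective e = trans (sym (decode-encode A)) (trans (cong decode e) (decode-encode B))

Atom : Set
Atom = ℕ ⊎ Fm

_≟ᵃ_ : DecidableEquality Atom
_≟ᵃ_ = Sum.≡-dec ℕ._≟_ _≟_

open DecMembership _≟ᵃ_ using (_∈?_)

-- The propositional atoms of a formula: inj₁ n is the variable n, inj₂ B the formula □ B.
atoms : Fm → List Atom
atoms (var n)  = inj₁ n ∷ []
atoms ⊥'       = []
atoms (¬' A)   = atoms A
atoms (A ∧' B) = atoms A ++ atoms B
atoms (A ∨' B) = atoms A ++ atoms B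
atoms (A ⇒ B)  = atoms A ++ atoms B
atoms (□ A)    = inj₂ A ∷ []

Valuation : Set
Valuation = Atom → Bool

⟦_⟧ : Fm → Valuation → Bool
⟦ A ⟧ ρ = evalP (ρ ∘ inj₁) (ρ ∘ inj₂) A

Agree : List Atom → Valuation → Valuation → Set
Agree L ρ ρ′ = ∀ {a} → a ∈ L → ρ a ≡ ρ′ a

⟦⟧-cong : ∀ A {ρ ρ′} → Agree (atoms A) ρ ρ′ → ⟦ A ⟧ ρ ≡ ⟦ A ⟧ ρ′
⟦⟧-cong (var n)  ag = ag (here refl)
⟦⟧-cong ⊥'       ag = refl
⟦⟧-cong (¬' A)   ag = cong not (⟦⟧-cong A ag)
⟦⟧-cong (A ∧' B) ag = cong₂ _∧_ (⟦⟧-cong A (ag ∘ ∈-++⁺ˡ)) (⟦⟧-cong B (ag ∘ ∈-++⁺ʳ (atoms A)))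
⟦⟧-cong (A ∨' B) ag = cong₂ _∨_ (⟦⟧-cong A (ag ∘ ∈-++⁺ˡ)) (⟦⟧-cong B (ag ∘ ∈-++⁺ʳ (atoms A)))
⟦⟧-cong (A ⇒ B)  ag =
  cong₂ (λ a b → not a ∨ b) (⟦⟧-cong A (ag ∘ ∈-++⁺ˡ)) (⟦⟧-cong B (ag ∘ ∈-++⁺ʳ (atoms A)))
⟦⟧-cong (□ A)    ag = ag (here refl)

_[_≔_] : Valuation → Atom → Bool → Valuation
(ρ [ k ≔ b ]) a with a ≟ᵃ k
... | yes _ = b
... | no _  = ρ a

update-cong : ∀ {L ρ ρ′} k b → Agree L ρ ρ′ → Agree (k ∷ L) (ρ [ k ≔ b ]) (ρ′ [ k ≔ b ])
update-cong k b ag {a} a∈ with a ≟ᵃ k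
... | yes _ = refl
... | no a≢k with a∈
...   | here a≡k = ⊥-elim (a≢k a≡k)
...   | there a∈L = ag a∈L

update-self : ∀ ρ k {a} → ρ a ≡ (ρ [ k ≔ ρ k ]) a
update-self ρ k {a} with a ≟ᵃ k
... | yes refl = refl
... | no _     = refl

search : ∀ {ℓ} (L : List Atom) (P : Valuation → Set ℓ) → (∀ ρ → Dec (P ρ)) →
         (∀ {ρ ρ′} → Agree L ρ ρ′ → P ρ → P ρ′) → ∃ P ⊎ (∀ ρ → ¬ P ρ)
search [] P P? resp with P? (λ _ → false)
... | yes p = inj₁ (_ , p)
... | no ¬p = inj₂ λ ρ p → ¬p (resp (λ ()) p)
search (k ∷ L) P P? resp
  with search L (P ∘ _[ k ≔ false ]) (P? ∘ _[ k ≔ false ]) (resp ∘ update-cong k false)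
     | search L (P ∘ _[ k ≔ true ]) (P? ∘ _[ k ≔ true ]) (resp ∘ update-cong k true)
... | inj₁ (ρ , p) | _            = inj₁ (_ , p)
... | inj₂ _       | inj₁ (ρ , p) = inj₁ (_ , p)
... | inj₂ none₀   | inj₂ none₁   = inj₂ λ ρ p → none (ρ k) ρ (resp (λ _ → update-self ρ k) p)
  where
  none : ∀ b ρ → ¬ P (ρ [ k ≔ b ])
  none false = none₀
  none true  = none₁

∈Sub-trans : ∀ {A B C} → A ∈Sub B → B ∈Sub C → A ∈Sub C
∈Sub-trans p here     = p
∈Sub-trans p (in¬ q)  = in¬ (∈Sub-trans p q)
∈Sub-trans p (in∧ˡ q) = in∧ˡ (∈Sub-trans p q)
∈Sub-trans p (in∧ʳ q) = in∧ʳ (∈Sub-trans p q)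
∈Sub-trans p (in∨ˡ q) = in∨ˡ (∈Sub-trans p q)
∈Sub-trans p (in∨ʳ q) = in∨ʳ (∈Sub-trans p q)
∈Sub-trans p (in⇒ˡ q) = in⇒ˡ (∈Sub-trans p q)
∈Sub-trans p (in⇒ʳ q) = in⇒ʳ (∈Sub-trans p q)
∈Sub-trans p (in□ q)  = in□ (∈Sub-trans p q)

SubSerial-mono : ∀ {A B F} → B ∈Sub A → SubSerial A F → SubSerial B F
SubSerial-mono B∈A s C □C∈B = s C (∈Sub-trans □C∈B B∈A)

SubSerial-¬ : ∀ {A F} → SubSerial A F → SubSerial (¬' A) F
SubSerial-¬ s C (in¬ □C∈A) = s C □C∈A

atom-∈Sub : ∀ A {B} → inj₂ B ∈ atoms A → (□ B) ∈Sub A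
atom-∈Sub (var n) (here ())
atom-∈Sub (var n) (there ())
atom-∈Sub (¬' A) m = in¬ (atom-∈Sub A m)
atom-∈Sub (A ∧' C) m = [ in∧ˡ ∘ atom-∈Sub A , in∧ʳ ∘ atom-∈Sub C ] (∈-++⁻ (atoms A) m)
atom-∈Sub (A ∨' C) m = [ in∨ˡ ∘ atom-∈Sub A , in∨ʳ ∘ atom-∈Sub C ] (∈-++⁻ (atoms A) m)
atom-∈Sub (A ⇒ C)  m = [ in⇒ˡ ∘ atom-∈Sub A , in⇒ʳ ∘ atom-∈Sub C ] (∈-++⁻ (atoms A) m)
atom-∈Sub (□ A) (here refl) = here
atom-∈Sub (□ A) (there ())

module Forcing {F : NFrame} {V : ℕ → NFrame.W F → Bool} {force : NFrame.W F → Fm → Bool}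
               (isF : IsForcing F V force) where
  open NFrame F
  open IsForcing isF

  valuationAt : W → Valuation
  valuationAt x = [ (λ n → V n x) , (λ B → force x (□ B)) ]

  force-⟦⟧ : ∀ x A → force x A ≡ ⟦ A ⟧ (valuationAt x)
  force-⟦⟧ x (var n)  = f-var x n
  force-⟦⟧ x ⊥'       = f-⊥ x
  force-⟦⟧ x (¬' A)   = trans (f-¬ x A) (cong not (force-⟦⟧ x A))
  force-⟦⟧ x (A ∧' B) = trans (f-∧ x A B) (cong₂ _∧_ (force-⟦⟧ x A) (force-⟦⟧ x B))
  force-⟦⟧ x (A ∨' B) = trans (f-∨ x A B) (cong₂ _∨_ (force-⟦⟧ x A) (force-⟦⟧ x B))
  force-⟦⟧ x (A ⇒ B)  = trans (f-⇒ x A B) (cong₂ (λ a b → not a ∨ b) (force-⟦⟧ x A) (force-⟦⟧ x B))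
  force-⟦⟧ x (□ A)    = refl

  ⇒-elim : ∀ {x A B} → force x (A ⇒ B) ≡ true → force x A ≡ true → force x B ≡ true
  ⇒-elim {x} {A} {B} h a = trans (cong (λ v → not v ∨ force x B) (sym a)) (trans (sym (f-⇒ x A B)) h)

  □-intro : ∀ x B → (∀ y → force y B ≡ true) → force x (□ B) ≡ true
  □-intro x B h = Equivalence.from (f-□ x B) (λ y _ → h y)

  □-elim : ∀ {x y} B → force x (□ B) ≡ true → rel B x y → force y B ≡ true
  □-elim {x} {y} B h = Equivalence.to (f-□ x B) h y

  ¬-true : ∀ x A → force x (¬' A) ≡ true → force x A ≢ true
  ¬-true x A ¬A⊨ A⊨ = not-¬ (sym A⊨) (sym (trans (sym (f-¬ x A)) ¬A⊨))

  ¬□-intro : ∀ x B → BSerial F B → (∀ y → force y (¬' B) ≡ true) → force x (¬' □ B) ≡ true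
  ¬□-intro x B serial h = trans (f-¬ x (□ B)) (cong not (¬-not □B≢true))
    where
    □B≢true : force x (□ B) ≢ true
    □B≢true □B = let (y , x≺y) = serial x in ¬-true y B (h y) (□-elim B □B x≺y)

sound : ∀ {A} → NR⊢ A → ∀ F → Serial F → ValidIn F A
sound d F serial V force isF = valid d
  where
  open Forcing isF
  valid : ∀ {A} → NR⊢ A → ∀ x → force x A ≡ true
  valid (taut t)  x = trans (force-⟦⟧ x _) (t _ _)
  valid (mp d e)  x = ⇒-elim (valid d x) (valid e x)
  valid (nec d)   x = □-intro x _ (valid d)
  valid (ruleR d) x = ¬□-intro x _ (serial _) (valid d)

-- Countermodels are deterministic: each world has exactly one B-successor for every B, so
-- forcing is a structurally recursive function and the frame is serial.
record DetModel : Set₁ where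
  field
    W    : Set
    root : W
    size : ℕ
    enum : W ↔ Fin size
    val  : ℕ → W → Bool
    next : W → Fm → W

module _ (M : DetModel) where
  open DetModel M

  forces : W → Fm → Bool
  forces x (var n)  = val n x
  forces x ⊥'       = false
  forces x (¬' A)   = not (forces x A)
  forces x (A ∧' B) = forces x A ∧ forces x B
  forces x (A ∨' B) = forces x A ∨ forces x B
  forces x (A ⇒ B)  = not (forces x A) ∨ forces x B
  forces x (□ A)    = forces (next x A) A

  frameOf : NFrame
  frameOf = record { W = W ; w₀ = root ; rel = λ B x y → next x B ≡ y }

  forces-isForcing : IsForcing frameOf val forces
  forces-isForcing = record
    { f-var = λ _ _ → refl ; f-⊥ = λ _ → refl ; f-¬ = λ _ _ → refl
    ; f-∧ = λ _ _ _ → refl ; f-∨ = λ _ _ _ → refl ; f-⇒ = λ _ _ _ → refl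
    ; f-□ = λ x B → mk⇔ (λ h y x≺y → subst (λ z → forces z B ≡ true) x≺y h) (λ h → h _ refl) }

  frameOf-finite : Finite frameOf
  frameOf-finite = size , enum

  frameOf-serial : Serial frameOf
  frameOf-serial B x = next x B , refl

record Embedding (M N : DetModel) : Set where
  private
    module M = DetModel M
    module N = DetModel N
  field
    embed      : M.W → N.W
    embed-val  : ∀ n x → N.val n (embed x) ≡ M.val n x
    embed-next : ∀ x B → N.next (embed x) B ≡ embed (M.next x B)

open Embedding

forces-embed : ∀ {M N} (e : Embedding M N) x A → forces N (embed e x) A ≡ forces M x A
forces-embed e x (var n)  = embed-val e n x
forces-embed e x ⊥'       = refl
forces-embed e x (¬' A)   = cong not (forces-embed e x A)
forces-embed e x (A ∧' B) = cong₂ _∧_ (forces-embed e x A) (forces-embed e x B)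
forces-embed e x (A ∨' B) = cong₂ _∨_ (forces-embed e x A) (forces-embed e x B)
forces-embed e x (A ⇒ B)  = cong₂ (λ a b → not a ∨ b) (forces-embed e x A) (forces-embed e x B)
forces-embed {M} {N} e x (□ A) =
  trans (cong (λ y → forces N y A) (embed-next e x A)) (forces-embed e (DetModel.next M x A) A)

_∘ᴱ_ : ∀ {L M N} → Embedding M N → Embedding L M → Embedding L N
f ∘ᴱ g = record
  { embed      = embed f ∘ embed g
  ; embed-val  = λ n x → trans (embed-val f n (embed g x)) (embed-val g n x)
  ; embed-next = λ x B → trans (embed-next f (embed g x) B) (cong (embed f) (embed-next g x B)) }

point : DetModel
point = record
  { W = ⊤ ; root = tt ; size = 1 ; enum = ↔-sym 1↔⊤ ; val = λ _ _ → false ; next = λ _ _ → tt }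

module _ (M N : DetModel) where
  private
    module M = DetModel M
    module N = DetModel N

  _⊕_ : DetModel
  _⊕_ = record
    { W    = M.W ⊎ N.W
    ; root = inj₁ M.root
    ; size = M.size + N.size
    ; enum = ↔-trans (M.enum ⊎-↔ N.enum) (↔-sym +↔⊎)
    ; val  = λ n → [ M.val n , N.val n ]
    ; next = λ { (inj₁ x) B → inj₁ (M.next x B) ; (inj₂ y) B → inj₂ (N.next y B) } }

  ⊕-inj₁ : Embedding M _⊕_
  ⊕-inj₁ = record { embed = inj₁ ; embed-val = λ _ _ → refl ; embed-next = λ _ _ → refl }

  ⊕-inj₂ : Embedding N _⊕_
  ⊕-inj₂ = record { embed = inj₂ ; embed-val = λ _ _ → refl ; embed-next = λ _ _ → refl }

Realizable : Fm → Bool → Set₁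
Realizable A b = Σ DetModel λ M → forces M (DetModel.root M) A ≡ b

realizable-¬ : ∀ A → Realizable (¬' A) false ⇔ Realizable A true
realizable-¬ _ = mk⇔ (λ (M , e) → M , not-injective e) (λ (M , e) → M , cong not e)

refutable⇒invalid : ∀ {A} → Realizable A false → ¬ (∀ F → Finite F → Serial F → ValidIn F A)
refutable⇒invalid (M , refuted) valid =
  not-¬ (valid (frameOf M) (frameOf-finite M) (frameOf-serial M) _ _ (forces-isForcing M) _) refuted

provable⇒irrefutable : ∀ {A} → NR⊢ A → ¬ Realizable A false
provable⇒irrefutable d r = refutable⇒invalid r (λ F _ → sound d F)

Realizes : Atom → Bool → Set₁
Realizes (inj₁ _) _ = Poly.⊤
Realizes (inj₂ B) b = Realizable B b

Admissible : List Atom → Valuation → Set₁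
Admissible L ρ = All (λ a → Realizes a (ρ a)) L

valuationOf : (M : DetModel) → DetModel.W M → Valuation
valuationOf M = Forcing.valuationAt (forces-isForcing M)

-- Below a fresh root, the disjoint union of models realizing the values ρ prescribes to the
-- boxed atoms; the root's B-successor is the root of the model for B, or the root itself
-- when □ B is not an atom.
module Graft (ρ : Valuation) where

  union : ∀ {L} → Admissible L ρ → DetModel
  union [] = point
  union {inj₁ _ ∷ _} (_ ∷ rs)      = union rs
  union {inj₂ _ ∷ _} ((M , _) ∷ rs) = M ⊕ union rs

  component : ∀ {L B} (rs : Admissible L ρ) (m : inj₂ B ∈ L) →
              Embedding (proj₁ (All.lookup rs m)) (union rs)
  component {inj₂ _ ∷ _} ((M , _) ∷ rs) (here refl) = ⊕-inj₁ M (union rs)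
  component {inj₁ _ ∷ _} (_ ∷ rs)       (there m)   = component rs m
  component {inj₂ _ ∷ _} ((M , _) ∷ rs) (there m)   = ⊕-inj₂ M (union rs) ∘ᴱ component rs m

  module _ {L} (rs : Admissible L ρ) where
    private module U = DetModel (union rs)

    rootNext : Fm → ⊤ ⊎ U.W
    rootNext B with inj₂ B ∈? L
    ... | yes m = inj₂ (embed (component rs m) (DetModel.root (proj₁ (All.lookup rs m))))
    ... | no _  = inj₁ tt

    graft : DetModel
    graft = record
      { W    = ⊤ ⊎ U.W
      ; root = inj₁ tt
      ; size = 1 + U.size
      ; enum = ↔-trans (↔-sym 1↔⊤ ⊎-↔ U.enum) (↔-sym +↔⊎)
      ; val  = λ n → [ (λ _ → ρ (inj₁ n)) , U.val n ]
      ; next = λ { (inj₁ _) B → rootNext B ; (inj₂ y) B → inj₂ (U.next y B) } }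

    union↪graft : Embedding (union rs) graft
    union↪graft = record { embed = inj₂ ; embed-val = λ _ _ → refl ; embed-next = λ _ _ → refl }

    graft-root : Agree L (valuationOf graft (inj₁ tt)) ρ
    graft-root {inj₁ n} _ = refl
    graft-root {inj₂ B} B∈L with inj₂ B ∈? L
    ... | no B∉L = ⊥-elim (B∉L B∈L)
    ... | yes m  = let (M , realized) = All.lookup rs m in begin
      forces graft (inj₂ (embed (component rs m) (DetModel.root M))) B
        ≡⟨ forces-embed union↪graft _ B ⟩
      forces (union rs) (embed (component rs m) (DetModel.root M)) B
        ≡⟨ forces-embed (component rs m) _ B ⟩
      forces M (DetModel.root M) B
        ≡⟨ realized ⟩
      ρ (inj₂ B) ∎
      where open ≡-Reasoning

SubValid : Fm → Set₁
SubValid A = ∀ F → SubSerial A F → ValidIn F A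

Verdict : Fm → Set₁
Verdict A = (NR⊢ A × SubValid A) ⊎ Realizable A false

AtomVerdicts : Atom → Set₁
AtomVerdicts (inj₁ _) = Poly.⊤
AtomVerdicts (inj₂ B) = Verdict B × Verdict (¬' B)

realizable? : ∀ {B} → Verdict B → Verdict (¬' B) → ∀ b → Dec (Realizable B b)
realizable?     (inj₁ (d , _)) _              false = no (provable⇒irrefutable d)
realizable?     (inj₂ r)       _              false = yes r
realizable? {B} _              (inj₁ (d , _)) true  =
  no (provable⇒irrefutable d ∘ Equivalence.from (realizable-¬ B))
realizable? {B} _              (inj₂ r)       true  = yes (Equivalence.to (realizable-¬ B) r)

admissible? : ∀ {L} → All AtomVerdicts L → ∀ ρ → Dec (Admissible L ρ)
admissible? [] ρ = yes []
admissible? {inj₁ _ ∷ _} (_ ∷ I) ρ = map′ (_ ∷_) All.tail (admissible? I ρ)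
admissible? {inj₂ B ∷ _} ((v , v¬) ∷ I) ρ =
  map′ (uncurry _∷_) All.uncons (realizable? v v¬ (ρ (inj₂ B)) ×-dec admissible? I ρ)

Counterexample : Fm → Valuation → Set₁
Counterexample A ρ = Admissible (atoms A) ρ × ⟦ A ⟧ ρ ≡ false

counterexample? : ∀ A → All AtomVerdicts (atoms A) → ∀ ρ → Dec (Counterexample A ρ)
counterexample? A I ρ = admissible? I ρ ×-dec ⟦ A ⟧ ρ ≟ᵇ false

counterexample-resp : ∀ A {ρ ρ′} → Agree (atoms A) ρ ρ′ → Counterexample A ρ → Counterexample A ρ′
counterexample-resp A ag (adm , refuted) =
  All.tabulate (λ {a} m → subst (Realizes a) (ag m) (All.lookup adm m)) ,
  trans (sym (⟦⟧-cong A ag)) refuted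

□-guard : ∀ {B} → Verdict B → Fm → Fm
□-guard {B} (inj₁ _) Y = □ B ⇒ Y
□-guard     (inj₂ _) Y = Y

¬□-guard : ∀ {B} → Verdict (¬' B) → Fm → Fm
¬□-guard {B} (inj₁ _) Y = ¬' □ B ⇒ Y
¬□-guard     (inj₂ _) Y = Y

guarded : ∀ {L} → All AtomVerdicts L → Fm → Fm
guarded [] Y = Y
guarded {inj₁ _ ∷ _} (_ ∷ I)        Y = guarded I Y
guarded {inj₂ B ∷ _} ((v , v¬) ∷ I) Y = □-guard {B} v (¬□-guard {B} v¬ (guarded I Y))

guarded-elim : ∀ {L} (I : All AtomVerdicts L) {Y} → NR⊢ guarded I Y → NR⊢ Y
guarded-elim [] d = d
guarded-elim {inj₁ _ ∷ _} (_ ∷ I) d = guarded-elim I d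
guarded-elim {inj₂ B ∷ _} ((v , v¬) ∷ I) d = guarded-elim I (discharge-¬□ v¬ (discharge-□ v d))
  where
  discharge-□ : ∀ v {Y} → NR⊢ □-guard {B} v Y → NR⊢ Y
  discharge-□ (inj₁ (⊢B , _)) d = mp d (nec ⊢B)
  discharge-□ (inj₂ _)        d = d
  discharge-¬□ : ∀ v¬ {Y} → NR⊢ ¬□-guard {B} v¬ Y → NR⊢ Y
  discharge-¬□ (inj₁ (⊢¬B , _)) d = mp d (ruleR ⊢¬B)
  discharge-¬□ (inj₂ _)         d = d

guards-true : ∀ {B} v v¬ ρ {Y} → (Realizable B (ρ (inj₂ B)) → ⟦ Y ⟧ ρ ≡ true) →
              ⟦ □-guard {B} v (¬□-guard {B} v¬ Y) ⟧ ρ ≡ true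
guards-true {B} (inj₁ _) (inj₁ _) ρ k with ρ (inj₂ B)
... | true  = refl
... | false = refl
guards-true {B} (inj₁ _) (inj₂ r¬) ρ k with ρ (inj₂ B)
... | true  = k (Equivalence.to (realizable-¬ B) r¬)
... | false = refl
guards-true {B} (inj₂ r) (inj₁ _) ρ k with ρ (inj₂ B)
... | true  = refl
... | false = k r
guards-true {B} (inj₂ r) (inj₂ r¬) ρ k with ρ (inj₂ B)
... | true  = k (Equivalence.to (realizable-¬ B) r¬)
... | false = k r

guarded-true : ∀ {L} (I : All AtomVerdicts L) ρ {Y} → (Admissible L ρ → ⟦ Y ⟧ ρ ≡ true) →
               ⟦ guarded I Y ⟧ ρ ≡ true
guarded-true [] ρ k = k []
guarded-true {inj₁ _ ∷ _} (_ ∷ I)        ρ k = guarded-true I ρ (k ∘ (_ ∷_))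
guarded-true {inj₂ B ∷ _} ((v , v¬) ∷ I) ρ k =
  guards-true v v¬ ρ (λ r → guarded-true I ρ (k ∘ (r ∷_)))

module _ {F : NFrame} {V : ℕ → NFrame.W F → Bool} {force : NFrame.W F → Fm → Bool}
         (isF : IsForcing F V force) where
  open Forcing isF
  open IsForcing isF

  realizable-at : ∀ {B} → Verdict B → Verdict (¬' B) → BSerial F B → SubSerial B F →
                  ∀ x → Realizable B (force x (□ B))
  realizable-at {B} v v¬ serial sub x with force x (□ B) in e | v | v¬
  ... | false | inj₂ r           | _ = r
  ... | false | inj₁ (_ , valid) | _ = ⊥-elim (not-¬ (□-intro x B (valid F sub V force isF)) e)
  ... | true  | _ | inj₂ r¬           = Equivalence.to (realizable-¬ B) r¬
  ... | true  | _ | inj₁ (_ , valid¬) =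
    ⊥-elim (¬-true x (□ B) (¬□-intro x B serial (valid¬ F (SubSerial-¬ {B} {F} sub) V force isF)) e)

  admissible-at : ∀ {A} → All AtomVerdicts (atoms A) → SubSerial A F →
                  ∀ x → Admissible (atoms A) (valuationAt x)
  admissible-at {A} I sub x = All.tabulate realizes
    where
    realizes : ∀ {a} → a ∈ atoms A → Realizes a (valuationAt x a)
    realizes {inj₁ _} _ = _
    realizes {inj₂ B} m with All.lookup I m
    ... | v , v¬ =
      realizable-at v v¬ (sub B □B∈A) (SubSerial-mono {F = F} (∈Sub-trans (in□ here) □B∈A) sub) x
      where
      □B∈A : (□ B) ∈Sub A
      □B∈A = atom-∈Sub A m

judge : ∀ A → All AtomVerdicts (atoms A) → Verdict A
judge A I with search (atoms A) (Counterexample A) (counterexample? A I) (counterexample-resp A)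
... | inj₁ (ρ , adm , refuted) = inj₂ (graft adm , root-refutes)
  where
  open Graft ρ
  open ≡-Reasoning
  root-refutes : forces (graft adm) (inj₁ tt) A ≡ false
  root-refutes = begin
    forces (graft adm) (inj₁ tt) A
      ≡⟨ Forcing.force-⟦⟧ (forces-isForcing (graft adm)) (inj₁ tt) A ⟩
    ⟦ A ⟧ (valuationOf (graft adm) (inj₁ tt))
      ≡⟨ ⟦⟧-cong A (graft-root adm) ⟩
    ⟦ A ⟧ ρ
      ≡⟨ refuted ⟩
    false ∎
... | inj₂ none = inj₁ (provable , valid)
  where
  holds : ∀ ρ → Admissible (atoms A) ρ → ⟦ A ⟧ ρ ≡ true
  holds ρ adm = ¬-not (λ refuted → none ρ (adm , refuted))
  provable : NR⊢ A
  provable = guarded-elim I (taut λ v b → guarded-true I [ v , b ] (holds _))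
  valid : SubValid A
  valid F sub V force isF x = trans (Forcing.force-⟦⟧ isF x A) (holds _ (admissible-at isF I sub x))

mutual
  verdict : ∀ A → Verdict A
  verdict A = judge A (atomVerdicts A)

  atomVerdicts : ∀ A → All AtomVerdicts (atoms A)
  atomVerdicts (var n)  = _ ∷ []
  atomVerdicts ⊥'       = []
  atomVerdicts (¬' A)   = atomVerdicts A
  atomVerdicts (A ∧' B) = ++⁺ (atomVerdicts A) (atomVerdicts B)
  atomVerdicts (A ∨' B) = ++⁺ (atomVerdicts A) (atomVerdicts B)
  atomVerdicts (A ⇒ B)  = ++⁺ (atomVerdicts A) (atomVerdicts B)
  -- judge (¬' A) rather than verdict (¬' A) keeps the recursion structural,
  -- as atoms (¬' A) is atoms A.
  atomVerdicts (□ A)    = (verdict A , judge (¬' A) (atomVerdicts A)) ∷ []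

complete : ∀ A → (∀ F → Finite F → Serial F → ValidIn F A) → NR⊢ A
complete A valid with verdict A
... | inj₁ (d , _) = d
... | inj₂ r       = ⊥-elim (refutable⇒invalid r valid)

sound-SubSerial : ∀ {A} → NR⊢ A → SubValid A
sound-SubSerial {A} d with verdict A
... | inj₁ (_ , valid) = valid
... | inj₂ r           = ⊥-elim (provable⇒irrefutable d r)

theorem3p12 : ∀ (A : Fm) →
    ((NR⊢ A) ⇔ (∀ (F : NFrame) → Serial F → ValidIn F A))
    × ((NR⊢ A) ⇔ (∀ (F : NFrame) → Finite F → Serial F → ValidIn F A))
    × ((NR⊢ A) ⇔ (∀ (F : NFrame) → Finite F → SubSerial A F → ValidIn F A))
theorem3p12 A =
    mk⇔ (λ d F → sound d F) (λ valid → complete A (λ F _ → valid F))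
  , mk⇔ (λ d F _ → sound d F) (complete A)
  , mk⇔ (λ d F _ → sound-SubSerial d F) (λ valid → complete A (λ F fin s → valid F fin (λ B _ → s B)))
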